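{- Let $n$ be a positive integer, and let $\vec n'$ and $\vec n''$ be the expansion of $n$ with no digit $0$ and the binary expansion of $n$, respectively. Then $$b(n)\geq \omega(\vec n')-\omega(\vec n'')+1,$$ with equality if and only if $n=2^{s+t+1}\pm 2^s-1$ for some $(s,t)\in\mathbb{N}_0\times\mathbb{N}_0$ and some choice of sign.
   Context: A hyperbinary expansion of a positive integer $n$ is a word $x_1\cdots x_k$ over $\{0,1,2\}$ with $x_1\neq 0$ and $n=\sum_{i=1}^k x_i2^{k-i}$; $b(n)$ is the number of hyperbinary expansions of $n$. $\vec n'$ is the unique hyperbinary expansion of $n$ without the digit $0$, and $\vec n''$ is the binary expansion of $n$. $\omega(x_1\cdots x_k)=x_1+\cdots+x_k$. $\mathbb{N}_0=\{0,1,2,\dots\}$. -}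

module Defs where

open import Data.Nat using (ℕ; zero; suc; _+_; _*_; _≟_)
open import Data.Fin using (Fin; toℕ) renaming (zero to fz; _≟_ to _≟ᶠ_)
open import Data.Nat.ListAction using (sum)
open import Data.List using (List; []; _∷_; foldl; map; length; filter; concat; concatMap; upTo)
open import Data.Product using (_×_; _,_)
open import Relation.Binary.PropositionalEquality using (_≡_; _≢_)
open import Relation.Nullary using (Dec; yes; no; ¬_)
open import Relation.Nullary.Decidable using (_×-dec_; ¬?)

-- A word over the alphabet {0,1,2}; digits are elements of Fin 3,
-- written most significant digit first.
Word : Set
Word = List (Fin 3)

val : Word → ℕ
val = foldl (λ acc d → 2 * acc + toℕ d) 0

ω : Word → ℕ
ω w = sum (map toℕ w)

HB : ℕ → Word → Set
HB n []       = Data.Empty.⊥ where import Data.Empty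
HB n (d ∷ ds) = (d ≢ fz) × (val (d ∷ ds) ≡ n)

HB? : (n : ℕ) (w : Word) → Dec (HB n w)
HB? n []       = no (λ ())
HB? n (d ∷ ds) = ¬? (d ≟ᶠ fz) ×-dec (val (d ∷ ds) ≟ n)

wordsOfLength : ℕ → List Word
wordsOfLength zero    = [] ∷ []
wordsOfLength (suc k) = concatMap (λ w → map (_∷ w) (Data.List.allFin 3)) (wordsOfLength k)
  where import Data.List

-- A hyperbinary expansion
-- of length k has value ≥ 2^(k-1) ≥ k, so every hyperbinary expansion of n
-- has length ≤ n; we therefore count among all words of length 0,…,n.
b : ℕ → ℕ
b n = length (filter (HB? n) (concat (map wordsOfLength (upTo (suc n)))))

-- Write n + 1 = 2^v (2j + 1). Since b(2m + 1) = b(m), we get b(n) = b(2j); reading the two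
-- expansions from their last digit shows that ω(n′) − ω(n″) is the number of binary digits
-- of j. So the theorem says b(2j) > bitLength j, with equality exactly for j = 2^t − 1 and
-- j = 2^t. From b(4i + 2) = b(i) + b(2i), b(4i + 4) = b(i) + b(2i + 2) and b ≥ 1 the
-- inequality follows by induction, and equality for j forces b(i) = 1, i.e. i = 2^t − 1.
module Submission where

open import Defs
open import Data.Nat using (ℕ; _+_; _^_; _≤_; NonZero)
open import Data.Fin using (toℕ) renaming (zero to fz)
open import Data.List.Relation.Unary.All using (All)
open import Data.Product using (_×_; ∃₂)
open import Data.Sum using (_⊎_)
open import Function.Bundles using (_⇔_)
open import Relation.Binary.PropositionalEquality using (_≡_; _≢_)

open import Data.Bool.Base using (true; false; if_then_else_)
open import Data.Empty using (⊥-elim)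
open import Data.Fin using (Fin) renaming (suc to fs)
open import Data.List using (List; []; _∷_; _∷ʳ_; _++_; map; concat; filter; length; upTo; allFin)
open import Data.List.Properties using (map-++; map-cong; map-∘; foldl-∷ʳ; upTo-∷ʳ)
open import Data.List.Relation.Unary.All.Properties using (∷ʳ⁻)
open import Data.List.Reverse using (Reverse; reverseView; []; _∶_∶ʳ_)
open import Data.Nat using (zero; suc; _*_; _<_; s≤s; z≤n)
open import Data.Nat.Binary.Base as ℕᵇ using (ℕᵇ; 2[1+_]; 1+[2_])
open import Data.Nat.Binary.Properties using (toℕ-fromℕ'; toℕ-injective)
open import Data.Nat.ListAction using (sum)
open import Data.Nat.ListAction.Properties using (sum-++)
open import Data.Nat.Properties
open import Data.Nat.Tactic.RingSolver using (solve-∀)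
open import Data.Product using (_,_; proj₁; proj₂; ∃)
open import Data.Sum using (inj₁; inj₂)
open import Function.Base using (id; _∘_)
open import Function.Bundles using (mk⇔; module Equivalence)
open import Relation.Binary.PropositionalEquality
  using (refl; sym; trans; cong; cong₂; subst; module ≡-Reasoning)
open import Relation.Nullary using (Dec; does; ¬_)
open import Relation.Nullary.Decidable using (does-⇔; dec-false)
open import Relation.Unary using (Decidable)
open import Algebra.Properties.CommutativeSemigroup +-commutativeSemigroup using (interchange)

𝟙 : {A : Set} → Dec A → ℕ
𝟙 a? = if does a? then 1 else 0

𝟙-⇔ : {A B : Set} → A ⇔ B → (a? : Dec A) (b? : Dec B) → 𝟙 a? ≡ 𝟙 b?
𝟙-⇔ A⇔B a? b? = cong (λ b → if b then 1 else 0) (does-⇔ A⇔B a? b?)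

𝟙-no : {A : Set} (a? : Dec A) → ¬ A → 𝟙 a? ≡ 0
𝟙-no a? ¬a = cong (λ b → if b then 1 else 0) (dec-false a? ¬a)

module _ {A : Set} where

  length-filter≡sum-𝟙 : {P : A → Set} (P? : Decidable P) (xs : List A) →
                        length (filter P? xs) ≡ sum (map (𝟙 ∘ P?) xs)
  length-filter≡sum-𝟙 P? []       = refl
  length-filter≡sum-𝟙 P? (x ∷ xs) with does (P? x)
  ... | true  = cong suc (length-filter≡sum-𝟙 P? xs)
  ... | false = length-filter≡sum-𝟙 P? xs

  sum-map-concat : (f : A → ℕ) (xss : List (List A)) →
                   sum (map f (concat xss)) ≡ sum (map (sum ∘ map f) xss)
  sum-map-concat f []         = refl
  sum-map-concat f (xs ∷ xss) = begin
    sum (map f (xs ++ concat xss))               ≡⟨ cong sum (map-++ f xs (concat xss)) ⟩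
    sum (map f xs ++ map f (concat xss))         ≡⟨ sum-++ (map f xs) (map f (concat xss)) ⟩
    sum (map f xs) + sum (map f (concat xss))    ≡⟨ cong (sum (map f xs) +_) (sum-map-concat f xss) ⟩
    sum (map f xs) + sum (map (sum ∘ map f) xss) ∎
    where open ≡-Reasoning

  sum-map-+ : (f g : A → ℕ) (xs : List A) →
              sum (map (λ x → f x + g x) xs) ≡ sum (map f xs) + sum (map g xs)
  sum-map-+ f g []       = refl
  sum-map-+ f g (x ∷ xs) = begin
    f x + g x + sum (map (λ x → f x + g x) xs)    ≡⟨ cong (f x + g x +_) (sum-map-+ f g xs) ⟩
    f x + g x + (sum (map f xs) + sum (map g xs)) ≡⟨ interchange (f x) (g x) _ _ ⟩
    f x + sum (map f xs) + (g x + sum (map g xs)) ∎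
    where open ≡-Reasoning

  sum-map-0 : (xs : List A) → sum (map (λ _ → 0) xs) ≡ 0
  sum-map-0 []       = refl
  sum-map-0 (_ ∷ xs) = sum-map-0 xs

sum-map-comm : {A B : Set} (f : A → B → ℕ) (xs : List A) (ys : List B) →
               sum (map (λ x → sum (map (f x) ys)) xs) ≡
               sum (map (λ y → sum (map (λ x → f x y) xs)) ys)
sum-map-comm f []       ys = sym (sum-map-0 ys)
sum-map-comm f (x ∷ xs) ys = begin
  sum (map (f x) ys) + sum (map (λ x → sum (map (f x) ys)) xs)
    ≡⟨ cong (sum (map (f x) ys) +_) (sum-map-comm f xs ys) ⟩
  sum (map (f x) ys) + sum (map (λ y → sum (map (λ x → f x y) xs)) ys)
    ≡⟨ sum-map-+ (f x) (λ y → sum (map (λ x → f x y) xs)) ys ⟨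
  sum (map (λ y → f x y + sum (map (λ x → f x y) xs)) ys) ∎
  where open ≡-Reasoning

sum-map-upTo-suc : (f : ℕ → ℕ) (n : ℕ) →
                   sum (map f (upTo (suc n))) ≡ sum (map f (upTo n)) + f n
sum-map-upTo-suc f n = begin
  sum (map f (upTo (suc n)))       ≡⟨ cong (sum ∘ map f) (upTo-∷ʳ n) ⟨
  sum (map f (upTo n ++ n ∷ []))   ≡⟨ cong sum (map-++ f (upTo n) (n ∷ [])) ⟩
  sum (map f (upTo n) ++ f n ∷ []) ≡⟨ sum-++ (map f (upTo n)) (f n ∷ []) ⟩
  sum (map f (upTo n)) + (f n + 0) ≡⟨ cong (sum (map f (upTo n)) +_) (+-identityʳ (f n)) ⟩
  sum (map f (upTo n)) + f n       ∎
  where open ≡-Reasoning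

-- Recursion and induction along n ↦ 2n + 1, 2n + 2

fromℕ'-1+2* : ∀ m → ℕᵇ.fromℕ' (1 + 2 * m) ≡ 1+[2 ℕᵇ.fromℕ' m ]
fromℕ'-1+2* m = toℕ-injective
  (trans (toℕ-fromℕ' _) (cong (λ k → 1 + 2 * k) (sym (toℕ-fromℕ' m))))

fromℕ'-2+2* : ∀ m → ℕᵇ.fromℕ' (2 + 2 * m) ≡ 2[1+ ℕᵇ.fromℕ' m ]
fromℕ'-2+2* m = toℕ-injective
  (trans (toℕ-fromℕ' _) (trans (sym (*-suc 2 m)) (cong (λ k → 2 * suc k) (sym (toℕ-fromℕ' m)))))

module BinaryRecursion {A : Set} (base : A) (odd : A → A) (even : A → A → A) where

  private
    -- both x = (rec (toℕ x) , rec (suc (toℕ x))): carrying the value at the successor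
    -- makes the even step, which needs rec (suc m), structurally recursive.
    both : ℕᵇ → A × A
    both ℕᵇ.zero   = base , odd base
    both 1+[2 x ] = odd (proj₁ (both x)) , even (proj₂ (both x)) (proj₁ (both x))
    both 2[1+ x ] = even (proj₂ (both x)) (proj₁ (both x)) , odd (proj₂ (both x))

    proj₂-both : ∀ x → proj₂ (both x) ≡ proj₁ (both (ℕᵇ.suc x))
    proj₂-both ℕᵇ.zero   = refl
    proj₂-both 1+[2 x ] = refl
    proj₂-both 2[1+ x ] = cong odd (proj₂-both x)

  rec : ℕ → A
  rec n = proj₁ (both (ℕᵇ.fromℕ' n))

  rec-odd : ∀ m → rec (1 + 2 * m) ≡ odd (rec m)
  rec-odd m = cong (proj₁ ∘ both) (fromℕ'-1+2* m)

  rec-even : ∀ m → rec (2 + 2 * m) ≡ even (rec (suc m)) (rec m)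
  rec-even m = trans (cong (proj₁ ∘ both) (fromℕ'-2+2* m))
                     (cong (λ a → even a (rec m)) (proj₂-both (ℕᵇ.fromℕ' m)))

binary-induction : (P : ℕ → Set) → P 0 → (∀ m → P m → P (1 + 2 * m)) →
                   (∀ m → P (suc m) → P m → P (2 + 2 * m)) → ∀ n → P n
binary-induction P P-zero P-odd P-even n =
  subst P (toℕ-fromℕ' n) (proj₁ (both (ℕᵇ.fromℕ' n)))
  where
  both : ∀ x → P (ℕᵇ.toℕ x) × P (suc (ℕᵇ.toℕ x))
  both ℕᵇ.zero   = P-zero , P-odd 0 P-zero
  both 1+[2 x ] = P-odd _ (proj₁ (both x)) , P-even _ (proj₂ (both x)) (proj₁ (both x))
  both 2[1+ x ] = subst P (sym (*-suc 2 (ℕᵇ.toℕ x))) (P-even _ (proj₂ (both x)) (proj₁ (both x)))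
                , P-odd _ (proj₂ (both x))

-- hyperbinary 0 = 1 counts the empty word, which b does not; so b ≡ hyperbinary only for n ≠ 0.
open BinaryRecursion 1 id _+_ public
  renaming (rec to hyperbinary; rec-odd to hyperbinary-odd; rec-even to hyperbinary-even)
open BinaryRecursion 0 suc (λ _ a → 2 + a) public
  renaming (rec to zeroFreeWeight; rec-odd to zeroFreeWeight-odd; rec-even to zeroFreeWeight-even)
open BinaryRecursion 0 suc (λ a _ → a) public
  renaming (rec to binaryWeight; rec-odd to binaryWeight-odd; rec-even to binaryWeight-even)
open BinaryRecursion 0 suc (λ a _ → suc a) public
  renaming (rec to bitLength; rec-odd to bitLength-odd; rec-even to bitLength-even)

binaryWeight-double : ∀ m → binaryWeight (2 * m) ≡ binaryWeight m
binaryWeight-double zero    = refl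
binaryWeight-double (suc m) = trans (cong binaryWeight (*-suc 2 m)) (binaryWeight-even m)

val-∷ʳ : ∀ w d → val (w ∷ʳ d) ≡ toℕ d + 2 * val w
val-∷ʳ w d = trans (foldl-∷ʳ _ 0 d w) (+-comm (2 * val w) (toℕ d))

ω-∷ʳ : ∀ w d → ω (w ∷ʳ d) ≡ toℕ d + ω w
ω-∷ʳ w d = begin
  sum (map toℕ (w ++ d ∷ []))   ≡⟨ cong sum (map-++ toℕ w (d ∷ [])) ⟩
  sum (map toℕ w ++ toℕ d ∷ []) ≡⟨ sum-++ (map toℕ w) (toℕ d ∷ []) ⟩
  ω w + (toℕ d + 0)             ≡⟨ cong (ω w +_) (+-identityʳ (toℕ d)) ⟩
  ω w + toℕ d                   ≡⟨ +-comm (ω w) (toℕ d) ⟩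
  toℕ d + ω w                   ∎
  where open ≡-Reasoning

ω≡f∘val : (f : ℕ → ℕ) (D : Fin 3 → Set) → f 0 ≡ 0 →
          (∀ d v → D d → f (toℕ d + 2 * v) ≡ toℕ d + f v) →
          ∀ {w} → All D w → ω w ≡ f (val w)
ω≡f∘val f D f-zero f-digit {w} = go (reverseView w)
  where
  open ≡-Reasoning
  go : ∀ {w} → Reverse w → All D w → ω w ≡ f (val w)
  go []              _  = sym f-zero
  go (ws ∶ r ∶ʳ d) Dw = begin
    ω (ws ∷ʳ d)            ≡⟨ ω-∷ʳ ws d ⟩
    toℕ d + ω ws           ≡⟨ cong (toℕ d +_) (go r (proj₁ (∷ʳ⁻ Dw))) ⟩
    toℕ d + f (val ws)     ≡⟨ f-digit d (val ws) (proj₂ (∷ʳ⁻ Dw)) ⟨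
    f (toℕ d + 2 * val ws) ≡⟨ cong f (val-∷ʳ ws d) ⟨
    f (val (ws ∷ʳ d))      ∎

ω-zeroFree : ∀ {w} → All (_≢ fz) w → ω w ≡ zeroFreeWeight (val w)
ω-zeroFree = ω≡f∘val zeroFreeWeight (_≢ fz) refl digit
  where
  digit : ∀ d v → d ≢ fz → zeroFreeWeight (toℕ d + 2 * v) ≡ toℕ d + zeroFreeWeight v
  digit fz           v d≢0 = ⊥-elim (d≢0 refl)
  digit (fs fz)      v _   = zeroFreeWeight-odd v
  digit (fs (fs fz)) v _   = zeroFreeWeight-even v

ω-binary : ∀ {w} → All (λ d → toℕ d ≤ 1) w → ω w ≡ binaryWeight (val w)
ω-binary = ω≡f∘val binaryWeight (λ d → toℕ d ≤ 1) refl digit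
  where
  digit : ∀ d v → toℕ d ≤ 1 → binaryWeight (toℕ d + 2 * v) ≡ toℕ d + binaryWeight v
  digit fz           v _        = binaryWeight-double v
  digit (fs fz)      v _        = binaryWeight-odd v
  digit (fs (fs fz)) v (s≤s ())

val-HB : ∀ {n} w → HB n w → val w ≡ n
val-HB (_ ∷ _) (_ , val≡n) = val≡n

-- Counting hyperbinary expansions

sumDigits : (Fin 3 → ℕ) → ℕ
sumDigits g = sum (map g (allFin 3))

sumWords : ℕ → (Word → ℕ) → ℕ
sumWords k f = sum (map f (wordsOfLength k))

sumWords-cong : ∀ k {f g} → (∀ w → f w ≡ g w) → sumWords k f ≡ sumWords k g
sumWords-cong k f≗g = cong sum (map-cong f≗g (wordsOfLength k))

sumWords-∷ : ∀ k f → sumWords (suc k) f ≡ sumWords k (λ w → sumDigits (λ d → f (d ∷ w)))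
sumWords-∷ k f = trans (sum-map-concat f (map _ (wordsOfLength k)))
                       (cong sum (sym (map-∘ (wordsOfLength k))))

sumWords-∷ʳ : ∀ k f → sumWords (suc k) f ≡ sumWords k (λ w → sumDigits (λ d → f (w ∷ʳ d)))
sumWords-∷ʳ zero    f = sym (+-identityʳ _)
sumWords-∷ʳ (suc k) f = begin
  sumWords (suc (suc k)) f
    ≡⟨ sumWords-∷ (suc k) f ⟩
  sumWords (suc k) (λ w → sumDigits λ d → f (d ∷ w))
    ≡⟨ sumWords-∷ʳ k _ ⟩
  sumWords k (λ u → sumDigits λ e → sumDigits λ d → f (d ∷ (u ∷ʳ e)))
    ≡⟨ sumWords-cong k (λ u → sum-map-comm (λ e d → f (d ∷ (u ∷ʳ e))) digits digits) ⟩
  sumWords k (λ u → sumDigits λ d → sumDigits λ e → f (d ∷ (u ∷ʳ e)))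
    ≡⟨ sumWords-∷ k _ ⟨
  sumWords (suc k) (λ w → sumDigits λ e → f (w ∷ʳ e)) ∎
  where
  open ≡-Reasoning
  digits = allFin 3

-- Leading zeros are allowed here, so these words split exactly according to their last digit.
#val≡ : ℕ → ℕ → ℕ
#val≡ k n = sumWords k (λ w → 𝟙 (val w ≟ n))

#HB : ℕ → ℕ → ℕ
#HB k n = sumWords k (λ w → 𝟙 (HB? n w))

-- A leading 0 never gives a hyperbinary expansion, while a leading 1 or 2 gives
-- one exactly when the value is right; both facts hold by computation.
#val≡-suc : ∀ k n → #val≡ (suc k) n ≡ #val≡ k n + #HB (suc k) n
#val≡-suc k n = begin
  #val≡ (suc k) n
    ≡⟨ sumWords-∷ k _ ⟩
  sumWords k (λ w → 𝟙 (val w ≟ n) + sumDigits (λ d → 𝟙 (HB? n (d ∷ w))))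
    ≡⟨ sum-map-+ _ _ (wordsOfLength k) ⟩
  #val≡ k n + sumWords k (λ w → sumDigits (λ d → 𝟙 (HB? n (d ∷ w))))
    ≡⟨ cong (#val≡ k n +_) (sumWords-∷ k _) ⟨
  #val≡ k n + #HB (suc k) n ∎
  where open ≡-Reasoning

sum-#HB≡#val≡ : ∀ n K → sum (map (λ k → #HB k (suc n)) (upTo (suc K))) ≡ #val≡ K (suc n)
sum-#HB≡#val≡ n zero    = refl
sum-#HB≡#val≡ n (suc K) = begin
  sum (map (λ k → #HB k (suc n)) (upTo (suc (suc K))))
    ≡⟨ sum-map-upTo-suc (λ k → #HB k (suc n)) (suc K) ⟩
  sum (map (λ k → #HB k (suc n)) (upTo (suc K))) + #HB (suc K) (suc n)
    ≡⟨ cong (_+ #HB (suc K) (suc n)) (sum-#HB≡#val≡ n K) ⟩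
  #val≡ K (suc n) + #HB (suc K) (suc n)
    ≡⟨ #val≡-suc K (suc n) ⟨
  #val≡ (suc K) (suc n) ∎
  where open ≡-Reasoning

b≡sum-#HB : ∀ n → b n ≡ sum (map (λ k → #HB k n) (upTo (suc n)))
b≡sum-#HB n = begin
  b n
    ≡⟨ length-filter≡sum-𝟙 (HB? n) (concat (map wordsOfLength (upTo (suc n)))) ⟩
  sum (map (𝟙 ∘ HB? n) (concat (map wordsOfLength (upTo (suc n)))))
    ≡⟨ sum-map-concat (𝟙 ∘ HB? n) (map wordsOfLength (upTo (suc n))) ⟩
  sum (map (sum ∘ map (𝟙 ∘ HB? n)) (map wordsOfLength (upTo (suc n))))
    ≡⟨ cong sum (map-∘ {g = sum ∘ map (𝟙 ∘ HB? n)} {f = wordsOfLength} (upTo (suc n))) ⟨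
  sum (map (λ k → #HB k n) (upTo (suc n))) ∎
  where open ≡-Reasoning

#lastDigits : ℕ → ℕ → ℕ
#lastDigits v n = sumDigits (λ d → 𝟙 (toℕ d + 2 * v ≟ n))

#val≡-∷ʳ : ∀ k n → #val≡ (suc k) n ≡ sumWords k (λ w → #lastDigits (val w) n)
#val≡-∷ʳ k n = trans (sumWords-∷ʳ k _) (sumWords-cong k λ w →
  cong sum (map-cong (λ d → cong (λ m → 𝟙 (m ≟ n)) (val-∷ʳ w d)) (allFin 3)))

#lastDigits-zero : ∀ v → #lastDigits v 0 ≡ 𝟙 (v ≟ 0)
#lastDigits-zero zero    = refl
#lastDigits-zero (suc v) = refl

#lastDigits-odd : ∀ v m → #lastDigits v (1 + 2 * m) ≡ 𝟙 (v ≟ m)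
#lastDigits-odd v m = begin
  𝟙 (2 * v ≟ 1 + 2 * m) + (𝟙 (1 + 2 * v ≟ 1 + 2 * m) + (𝟙 (2 + 2 * v ≟ 1 + 2 * m) + 0))
    ≡⟨ cong₂ _+_ last-0 (cong₂ _+_ last-1 (cong (_+ 0) last-2)) ⟩
  𝟙 (v ≟ m) + 0
    ≡⟨ +-identityʳ _ ⟩
  𝟙 (v ≟ m) ∎
  where
  open ≡-Reasoning
  last-0 : 𝟙 (2 * v ≟ 1 + 2 * m) ≡ 0
  last-0 = 𝟙-no (2 * v ≟ _) (even≢odd v m)
  last-1 : 𝟙 (1 + 2 * v ≟ 1 + 2 * m) ≡ 𝟙 (v ≟ m)
  last-1 = 𝟙-⇔ (mk⇔ (*-cancelˡ-≡ v m 2 ∘ suc-injective) (cong (λ x → 1 + 2 * x)))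
               (1 + 2 * v ≟ _) (v ≟ m)
  last-2 : 𝟙 (2 + 2 * v ≟ 1 + 2 * m) ≡ 0
  last-2 = 𝟙-no (2 + 2 * v ≟ _) (even≢odd (suc v) m ∘ trans (*-suc 2 v))

#lastDigits-even : ∀ v m → #lastDigits v (2 + 2 * m) ≡ 𝟙 (v ≟ suc m) + 𝟙 (v ≟ m)
#lastDigits-even v m = begin
  𝟙 (2 * v ≟ 2 + 2 * m) + (𝟙 (1 + 2 * v ≟ 2 + 2 * m) + (𝟙 (2 + 2 * v ≟ 2 + 2 * m) + 0))
    ≡⟨ cong₂ _+_ last-0 (cong₂ _+_ last-1 (cong (_+ 0) last-2)) ⟩
  𝟙 (v ≟ suc m) + (0 + (𝟙 (v ≟ m) + 0))
    ≡⟨ cong (𝟙 (v ≟ suc m) +_) (+-identityʳ _) ⟩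
  𝟙 (v ≟ suc m) + 𝟙 (v ≟ m) ∎
  where
  open ≡-Reasoning
  last-0 : 𝟙 (2 * v ≟ 2 + 2 * m) ≡ 𝟙 (v ≟ suc m)
  last-0 = 𝟙-⇔ (mk⇔ (λ e → *-cancelˡ-≡ v (suc m) 2 (trans e (sym (*-suc 2 m))))
                    (λ e → trans (cong (2 *_) e) (*-suc 2 m)))
               (2 * v ≟ _) (v ≟ suc m)
  last-1 : 𝟙 (1 + 2 * v ≟ 2 + 2 * m) ≡ 0
  last-1 = 𝟙-no (1 + 2 * v ≟ _) (λ e → even≢odd (suc m) v (trans (*-suc 2 m) (sym e)))
  last-2 : 𝟙 (2 + 2 * v ≟ 2 + 2 * m) ≡ 𝟙 (v ≟ m)
  last-2 = 𝟙-⇔ (mk⇔ (*-cancelˡ-≡ v m 2 ∘ suc-injective ∘ suc-injective)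
                    (cong (λ x → 2 + 2 * x)))
               (2 + 2 * v ≟ _) (v ≟ m)

#val≡-zero : ∀ k → #val≡ k 0 ≡ 1
#val≡-zero zero    = refl
#val≡-zero (suc k) = trans (#val≡-∷ʳ k 0)
  (trans (sumWords-cong k (#lastDigits-zero ∘ val)) (#val≡-zero k))

#val≡-odd : ∀ k m → #val≡ (suc k) (1 + 2 * m) ≡ #val≡ k m
#val≡-odd k m = trans (#val≡-∷ʳ k _) (sumWords-cong k (λ w → #lastDigits-odd (val w) m))

#val≡-even : ∀ k m → #val≡ (suc k) (2 + 2 * m) ≡ #val≡ k (suc m) + #val≡ k m
#val≡-even k m = trans (#val≡-∷ʳ k _)
  (trans (sumWords-cong k (λ w → #lastDigits-even (val w) m)) (sum-map-+ _ _ (wordsOfLength k)))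

#val≡-hyperbinary : ∀ n k → n ≤ k → #val≡ k n ≡ hyperbinary n
#val≡-hyperbinary = binary-induction P (λ k _ → #val≡-zero k) odd even
  where
  P : ℕ → Set
  P n = ∀ k → n ≤ k → #val≡ k n ≡ hyperbinary n
  odd : ∀ m → P m → P (1 + 2 * m)
  odd m ih (suc k) (s≤s 2m≤k) = trans (#val≡-odd k m)
    (trans (ih k (≤-trans (m≤m+n m _) 2m≤k)) (sym (hyperbinary-odd m)))
  even : ∀ m → P (suc m) → P m → P (2 + 2 * m)
  even m ih′ ih (suc k) (s≤s 1+2m≤k) = trans (#val≡-even k m)
    (trans (cong₂ _+_ (ih′ k 1+m≤k) (ih k (≤-trans (n≤1+n m) 1+m≤k)))
           (sym (hyperbinary-even m)))
    where 1+m≤k = ≤-trans (s≤s (m≤m+n m _)) 1+2m≤k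

b≡hyperbinary : ∀ n .{{_ : NonZero n}} → b n ≡ hyperbinary n
b≡hyperbinary (suc n) = trans (b≡sum-#HB (suc n))
  (trans (sum-#HB≡#val≡ n (suc n)) (#val≡-hyperbinary (suc n) (suc n) ≤-refl))

-- b(2j) against the bit length of j

hyperbinary>0 : ∀ n → 0 < hyperbinary n
hyperbinary>0 = binary-induction (λ n → 0 < hyperbinary n) (s≤s z≤n)
  (λ m h>0 → ≤-trans h>0 (≤-reflexive (sym (hyperbinary-odd m))))
  (λ m h′>0 _ → ≤-trans (≤-trans h′>0 (m≤m+n _ _)) (≤-reflexive (sym (hyperbinary-even m))))

hyperbinary-double-odd : ∀ i → hyperbinary (2 * (1 + 2 * i)) ≡ hyperbinary i + hyperbinary (2 * i)
hyperbinary-double-odd i = begin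
  hyperbinary (2 * (1 + 2 * i))                 ≡⟨ cong hyperbinary (*-suc 2 (2 * i)) ⟩
  hyperbinary (2 + 2 * (2 * i))                 ≡⟨ hyperbinary-even (2 * i) ⟩
  hyperbinary (1 + 2 * i) + hyperbinary (2 * i) ≡⟨ cong (_+ hyperbinary (2 * i)) (hyperbinary-odd i) ⟩
  hyperbinary i + hyperbinary (2 * i)           ∎
  where open ≡-Reasoning

hyperbinary-double-even : ∀ i →
  hyperbinary (2 * (2 + 2 * i)) ≡ hyperbinary i + hyperbinary (2 * suc i)
hyperbinary-double-even i = begin
  hyperbinary (2 * (2 + 2 * i))
    ≡⟨ cong hyperbinary (*-suc 2 (1 + 2 * i)) ⟩
  hyperbinary (2 + 2 * (1 + 2 * i))
    ≡⟨ hyperbinary-even (1 + 2 * i) ⟩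
  hyperbinary (2 + 2 * i) + hyperbinary (1 + 2 * i)
    ≡⟨ cong₂ _+_ (cong hyperbinary (sym (*-suc 2 i))) (hyperbinary-odd i) ⟩
  hyperbinary (2 * suc i) + hyperbinary i
    ≡⟨ +-comm _ (hyperbinary i) ⟩
  hyperbinary i + hyperbinary (2 * suc i) ∎
  where open ≡-Reasoning

bitLength<hyperbinary-double : ∀ j → bitLength j < hyperbinary (2 * j)
bitLength<hyperbinary-double = binary-induction P (s≤s z≤n) odd even
  where
  open ≤-Reasoning
  P : ℕ → Set
  P j = bitLength j < hyperbinary (2 * j)
  odd : ∀ i → P i → P (1 + 2 * i)
  odd i ih = begin-strict
    bitLength (1 + 2 * i)               ≡⟨ bitLength-odd i ⟩
    suc (bitLength i)                   <⟨ +-mono-≤ (hyperbinary>0 i) ih ⟩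
    hyperbinary i + hyperbinary (2 * i) ≡⟨ hyperbinary-double-odd i ⟨
    hyperbinary (2 * (1 + 2 * i))       ∎
  even : ∀ i → P (suc i) → P i → P (2 + 2 * i)
  even i ih′ _ = begin-strict
    bitLength (2 + 2 * i)                   ≡⟨ bitLength-even i ⟩
    suc (bitLength (suc i))                 <⟨ +-mono-≤ (hyperbinary>0 i) ih′ ⟩
    hyperbinary i + hyperbinary (2 * suc i) ≡⟨ hyperbinary-double-even i ⟨
    hyperbinary (2 * (2 + 2 * i))           ∎

Tight : ℕ → Set
Tight j = hyperbinary (2 * j) ≡ suc (bitLength j)

allOnes : ℕ → ℕ
allOnes zero    = 0
allOnes (suc t) = 1 + 2 * allOnes t

suc-allOnes : ∀ t → suc (allOnes t) ≡ 2 ^ t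
suc-allOnes zero    = refl
suc-allOnes (suc t) = trans (sym (*-suc 2 (allOnes t))) (cong (2 *_) (suc-allOnes t))

hyperbinary-allOnes : ∀ t → hyperbinary (allOnes t) ≡ 1
hyperbinary-allOnes zero    = refl
hyperbinary-allOnes (suc t) = trans (hyperbinary-odd (allOnes t)) (hyperbinary-allOnes t)

hyperbinary≡1⇒allOnes : ∀ n → hyperbinary n ≡ 1 → ∃ λ t → n ≡ allOnes t
hyperbinary≡1⇒allOnes = binary-induction P (λ _ → 0 , refl) odd even
  where
  P : ℕ → Set
  P n = hyperbinary n ≡ 1 → ∃ λ t → n ≡ allOnes t
  odd : ∀ m → P m → P (1 + 2 * m)
  odd m ih h≡1 with ih (trans (sym (hyperbinary-odd m)) h≡1)
  ... | t , m≡ = suc t , cong (λ x → 1 + 2 * x) m≡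
  even : ∀ m → P (suc m) → P m → P (2 + 2 * m)
  even m _ _ h≡1 with ≤-trans (+-mono-≤ (hyperbinary>0 (suc m)) (hyperbinary>0 m))
                              (≤-reflexive (trans (sym (hyperbinary-even m)) h≡1))
  ... | s≤s ()

tight-allOnes : ∀ t → Tight (allOnes t)
tight-allOnes zero    = refl
tight-allOnes (suc t) = begin
  hyperbinary (2 * (1 + 2 * a))       ≡⟨ hyperbinary-double-odd a ⟩
  hyperbinary a + hyperbinary (2 * a) ≡⟨ cong₂ _+_ (hyperbinary-allOnes t) (tight-allOnes t) ⟩
  suc (suc (bitLength a))             ≡⟨ cong suc (bitLength-odd a) ⟨
  suc (bitLength (1 + 2 * a))         ∎
  where
  open ≡-Reasoning
  a = allOnes t

tight-2^ : ∀ t → Tight (2 ^ t)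
tight-2^ zero    = refl
tight-2^ (suc t) = begin
  hyperbinary (2 * 2 ^ suc t)             ≡⟨ cong (λ x → hyperbinary (2 * x)) 2^suc ⟩
  hyperbinary (2 * (2 + 2 * a))           ≡⟨ hyperbinary-double-even a ⟩
  hyperbinary a + hyperbinary (2 * suc a) ≡⟨ cong₂ _+_ (hyperbinary-allOnes t)
                                               (cong (λ x → hyperbinary (2 * x)) (suc-allOnes t)) ⟩
  suc (hyperbinary (2 * 2 ^ t))           ≡⟨ cong suc (tight-2^ t) ⟩
  suc (suc (bitLength (2 ^ t)))           ≡⟨ cong (suc ∘ suc ∘ bitLength) (suc-allOnes t) ⟨
  suc (suc (bitLength (suc a)))           ≡⟨ cong suc (bitLength-even a) ⟨
  suc (bitLength (2 + 2 * a))             ≡⟨ cong (suc ∘ bitLength) 2^suc ⟨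
  suc (bitLength (2 ^ suc t))             ∎
  where
  open ≡-Reasoning
  a = allOnes t
  2^suc : 2 ^ suc t ≡ 2 + 2 * a
  2^suc = trans (cong (2 *_) (sym (suc-allOnes t))) (*-suc 2 a)

+-squeeze : ∀ {a b c} → 1 ≤ a → c ≤ b → a + b ≡ 1 + c → a ≡ 1
+-squeeze {a} {b} 1≤a c≤b a+b≡1+c =
  ≤-antisym (+-cancelʳ-≤ b a 1 (≤-trans (≤-reflexive a+b≡1+c) (s≤s c≤b))) 1≤a

tight⇒allOnes⊎2^ : ∀ j → Tight j → (∃ λ t → j ≡ allOnes t) ⊎ (∃ λ t → j ≡ 2 ^ t)
tight⇒allOnes⊎2^ = binary-induction P (λ _ → inj₁ (0 , refl)) odd even
  where
  P : ℕ → Set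
  P j = Tight j → (∃ λ t → j ≡ allOnes t) ⊎ (∃ λ t → j ≡ 2 ^ t)
  odd : ∀ i → P i → P (1 + 2 * i)
  odd i _ tight with hyperbinary≡1⇒allOnes i
    (+-squeeze (hyperbinary>0 i) (bitLength<hyperbinary-double i)
      (trans (sym (hyperbinary-double-odd i)) (trans tight (cong suc (bitLength-odd i)))))
  ... | t , i≡ = inj₁ (suc t , cong (λ x → 1 + 2 * x) i≡)
  even : ∀ i → P (suc i) → P i → P (2 + 2 * i)
  even i _ _ tight with hyperbinary≡1⇒allOnes i
    (+-squeeze (hyperbinary>0 i) (bitLength<hyperbinary-double (suc i))
      (trans (sym (hyperbinary-double-even i)) (trans tight (cong suc (bitLength-even i)))))
  ... | t , i≡ = inj₂ (suc t , trans (sym (*-suc 2 i))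
                                     (cong (2 *_) (trans (cong suc i≡) (suc-allOnes t))))

-- The odd part of n + 1

zeroFreeWeight-suc : ∀ m → 2 + zeroFreeWeight m ≡ bitLength (suc m) + binaryWeight (suc m)
zeroFreeWeight-suc = binary-induction P refl odd even
  where
  open ≡-Reasoning
  P : ℕ → Set
  P m = 2 + zeroFreeWeight m ≡ bitLength (suc m) + binaryWeight (suc m)
  odd : ∀ i → P i → P (1 + 2 * i)
  odd i ih = begin
    2 + zeroFreeWeight (1 + 2 * i)
      ≡⟨ cong (2 +_) (zeroFreeWeight-odd i) ⟩
    suc (2 + zeroFreeWeight i)
      ≡⟨ cong suc ih ⟩
    suc (bitLength (suc i) + binaryWeight (suc i))
      ≡⟨ cong₂ _+_ (bitLength-even i) (binaryWeight-even i) ⟨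
    bitLength (2 + 2 * i) + binaryWeight (2 + 2 * i) ∎
  even : ∀ i → P (suc i) → P i → P (2 + 2 * i)
  even i _ ih = begin
    2 + zeroFreeWeight (2 + 2 * i)
      ≡⟨ cong (2 +_) (zeroFreeWeight-even i) ⟩
    2 + (2 + zeroFreeWeight i)
      ≡⟨ cong (2 +_) ih ⟩
    2 + (bitLength (suc i) + binaryWeight (suc i))
      ≡⟨ cong suc (+-suc _ _) ⟨
    suc (bitLength (suc i)) + suc (binaryWeight (suc i))
      ≡⟨ cong₂ _+_ (bitLength-odd (suc i)) (binaryWeight-odd (suc i)) ⟨
    bitLength (1 + 2 * suc i) + binaryWeight (1 + 2 * suc i)
      ≡⟨ cong (λ x → bitLength (suc x) + binaryWeight (suc x)) (*-suc 2 i) ⟩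
    bitLength (3 + 2 * i) + binaryWeight (3 + 2 * i) ∎

zeroFreeWeight-double : ∀ j → zeroFreeWeight (2 * j) ≡ bitLength j + binaryWeight (2 * j)
zeroFreeWeight-double zero    = refl
zeroFreeWeight-double (suc j) = begin
  zeroFreeWeight (2 * suc j)
    ≡⟨ cong zeroFreeWeight (*-suc 2 j) ⟩
  zeroFreeWeight (2 + 2 * j)
    ≡⟨ zeroFreeWeight-even j ⟩
  2 + zeroFreeWeight j
    ≡⟨ zeroFreeWeight-suc j ⟩
  bitLength (suc j) + binaryWeight (suc j)
    ≡⟨ cong (bitLength (suc j) +_) (binaryWeight-double (suc j)) ⟨
  bitLength (suc j) + binaryWeight (2 * suc j) ∎
  where open ≡-Reasoning

-- OddPart n j : the odd part of n + 1 is 2j + 1.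
data OddPart : ℕ → ℕ → Set where
  odd-part : ∀ j → OddPart (2 * j) j
  double   : ∀ {m j} → OddPart m j → OddPart (1 + 2 * m) j

oddPart : ∀ n → ∃ (OddPart n)
oddPart = binary-induction (λ n → ∃ (OddPart n)) (0 , odd-part 0)
  (λ m (j , p) → j , double p)
  (λ m _ _ → suc m , subst (λ n → OddPart n (suc m)) (*-suc 2 m) (odd-part (suc m)))

OddPart⇔ : ∀ {n j} → OddPart n j ⇔ ∃ λ v → suc n ≡ 2 ^ v * (1 + 2 * j)
OddPart⇔ = mk⇔ to (λ (v , e) → from v e)
  where
  to : ∀ {n j} → OddPart n j → ∃ λ v → suc n ≡ 2 ^ v * (1 + 2 * j)
  to (odd-part j)       = 0 , sym (*-identityˡ _)
  to (double {m} {j} p) with to p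
  ... | v , e = suc v , trans (sym (*-suc 2 m)) (trans (cong (2 *_) e) (sym (*-assoc 2 (2 ^ v) _)))
  from : ∀ {n j} v → suc n ≡ 2 ^ v * (1 + 2 * j) → OddPart n j
  from {n} {j} zero e =
    subst (λ k → OddPart k j) (sym (suc-injective (trans e (*-identityˡ _)))) (odd-part j)
  from {n} {j} (suc v) e with 2 ^ v * (1 + 2 * j) in eq | trans e (*-assoc 2 (2 ^ v) _)
  ... | suc m | e′ = subst (λ k → OddPart k j) (sym (suc-injective (trans e′ (*-suc 2 m))))
                           (double (from v (sym eq)))

hyperbinary-oddPart : ∀ {n j} → OddPart n j → hyperbinary n ≡ hyperbinary (2 * j)
hyperbinary-oddPart (odd-part j)   = refl
hyperbinary-oddPart (double {m} p) = trans (hyperbinary-odd m) (hyperbinary-oddPart p)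

zeroFreeWeight-oddPart : ∀ {n j} → OddPart n j → zeroFreeWeight n ≡ bitLength j + binaryWeight n
zeroFreeWeight-oddPart (odd-part j)       = zeroFreeWeight-double j
zeroFreeWeight-oddPart (double {m} {j} p) = begin
  zeroFreeWeight (1 + 2 * m)             ≡⟨ zeroFreeWeight-odd m ⟩
  suc (zeroFreeWeight m)                 ≡⟨ cong suc (zeroFreeWeight-oddPart p) ⟩
  suc (bitLength j + binaryWeight m)     ≡⟨ +-suc _ _ ⟨
  bitLength j + suc (binaryWeight m)     ≡⟨ cong (bitLength j +_) (binaryWeight-odd m) ⟨
  bitLength j + binaryWeight (1 + 2 * m) ∎
  where open ≡-Reasoning

module _ {n j} (p : OddPart n j) where

  private
    hyperbinary+binaryWeight : hyperbinary n + binaryWeight n ≡ hyperbinary (2 * j) + binaryWeight n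
    hyperbinary+binaryWeight = cong (_+ binaryWeight n) (hyperbinary-oddPart p)

    zeroFreeWeight+1 : zeroFreeWeight n + 1 ≡ suc (bitLength j) + binaryWeight n
    zeroFreeWeight+1 = trans (+-comm _ 1) (cong suc (zeroFreeWeight-oddPart p))

  weight-bound : zeroFreeWeight n + 1 ≤ hyperbinary n + binaryWeight n
  weight-bound = ≤-trans (≤-reflexive zeroFreeWeight+1)
    (≤-trans (+-monoˡ-≤ (binaryWeight n) (bitLength<hyperbinary-double j))
             (≤-reflexive (sym hyperbinary+binaryWeight)))

  weight-equality⇔tight : (hyperbinary n + binaryWeight n ≡ zeroFreeWeight n + 1) ⇔ Tight j
  weight-equality⇔tight = mk⇔
    (λ e → +-cancelʳ-≡ (binaryWeight n) _ _
             (trans (sym hyperbinary+binaryWeight) (trans e zeroFreeWeight+1)))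
    (λ e → trans hyperbinary+binaryWeight
             (trans (cong (_+ binaryWeight n) e) (sym zeroFreeWeight+1)))

-- The equality cases n = 2^(s+t+1) ± 2^s − 1

EqualityCase : ℕ → Set
EqualityCase n =
  ∃₂ λ s t → (n + 1 ≡ 2 ^ (s + t + 1) + 2 ^ s) ⊎ (n + 1 + 2 ^ s ≡ 2 ^ (s + t + 1))

2^[s+t+1] : ∀ s t → 2 ^ (s + t + 1) ≡ 2 ^ s * (2 * 2 ^ t)
2^[s+t+1] s t = trans (cong (2 ^_) (trans (+-assoc s t 1) (cong (s +_) (+-comm t 1))))
                      (^-distribˡ-+-* 2 s (suc t))

oddPart-2^⇔ : ∀ n s t → suc n ≡ 2 ^ s * (1 + 2 * 2 ^ t) ⇔ n + 1 ≡ 2 ^ (s + t + 1) + 2 ^ s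
oddPart-2^⇔ n s t = mk⇔ (λ e → trans (+-comm n 1) (trans e (sym 2^[s+t+1]+2^s)))
                         (λ e → trans (+-comm 1 n) (trans e 2^[s+t+1]+2^s))
  where
  identity : ∀ x y → x * (2 * y) + x ≡ x * (1 + 2 * y)
  identity = solve-∀
  2^[s+t+1]+2^s : 2 ^ (s + t + 1) + 2 ^ s ≡ 2 ^ s * (1 + 2 * 2 ^ t)
  2^[s+t+1]+2^s = trans (cong (_+ 2 ^ s) (2^[s+t+1] s t)) (identity (2 ^ s) (2 ^ t))

oddPart-allOnes⇔ : ∀ n s t →
  suc n ≡ 2 ^ s * (1 + 2 * allOnes t) ⇔ n + 1 + 2 ^ s ≡ 2 ^ (s + t + 1)
oddPart-allOnes⇔ n s t = mk⇔
  (λ e → trans (cong (_+ 2 ^ s) (trans (+-comm n 1) e)) (sym 2^[s+t+1]≡))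
  (λ e → trans (+-comm 1 n) (+-cancelʳ-≡ (2 ^ s) _ _ (trans e 2^[s+t+1]≡)))
  where
  identity : ∀ x a → x * (2 * suc a) ≡ x * (1 + 2 * a) + x
  identity = solve-∀
  2^[s+t+1]≡ : 2 ^ (s + t + 1) ≡ 2 ^ s * (1 + 2 * allOnes t) + 2 ^ s
  2^[s+t+1]≡ = trans (2^[s+t+1] s t)
    (trans (cong (λ y → 2 ^ s * (2 * y)) (sym (suc-allOnes t))) (identity (2 ^ s) (allOnes t)))

weight-equality⇔equalityCase : ∀ n →
  (hyperbinary n + binaryWeight n ≡ zeroFreeWeight n + 1) ⇔ EqualityCase n
weight-equality⇔equalityCase n = mk⇔ to from
  where
  open Equivalence using () renaming (to to ⇒; from to ⇐)
  oddPart-of : ∀ s j → suc n ≡ 2 ^ s * (1 + 2 * j) → OddPart n j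
  oddPart-of s j e = ⇐ OddPart⇔ (s , e)
  to : hyperbinary n + binaryWeight n ≡ zeroFreeWeight n + 1 → EqualityCase n
  to e with oddPart n
  ... | j , p with ⇒ OddPart⇔ p | tight⇒allOnes⊎2^ j (⇒ (weight-equality⇔tight p) e)
  ...   | v , p′ | inj₁ (t , refl) = v , t , inj₂ (⇒ (oddPart-allOnes⇔ n v t) p′)
  ...   | v , p′ | inj₂ (t , refl) = v , t , inj₁ (⇒ (oddPart-2^⇔ n v t) p′)
  from : EqualityCase n → hyperbinary n + binaryWeight n ≡ zeroFreeWeight n + 1
  from (s , t , inj₁ e) =
    ⇐ (weight-equality⇔tight (oddPart-of s (2 ^ t) (⇐ (oddPart-2^⇔ n s t) e))) (tight-2^ t)
  from (s , t , inj₂ e) =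
    ⇐ (weight-equality⇔tight (oddPart-of s (allOnes t) (⇐ (oddPart-allOnes⇔ n s t) e)))
      (tight-allOnes t)

corollary5p7 : (n : ℕ) → .{{_ : NonZero n}} →
    (n′ : Word) → HB n n′ → All (λ d → d ≢ fz) n′ →
    (n″ : Word) → HB n n″ → All (λ d → toℕ d ≤ 1) n″ →
    (ω n′ + 1 ≤ b n + ω n″)
    × ((b n + ω n″ ≡ ω n′ + 1) ⇔
       ∃₂ λ s t → (n + 1 ≡ 2 ^ (s + t + 1) + 2 ^ s) ⊎ (n + 1 + 2 ^ s ≡ 2 ^ (s + t + 1)))
corollary5p7 n ⦃ n≢0 ⦄ n′ n′-hyperbinary n′-zeroFree n″ n″-hyperbinary n″-binary
  rewrite b≡hyperbinary n ⦃ n≢0 ⦄ | ω-zeroFree n′-zeroFree | ω-binary n″-binary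
        | val-HB n′ n′-hyperbinary | val-HB n″ n″-hyperbinary
  = weight-bound (proj₂ (oddPart n)) , weight-equality⇔equalityCase n
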